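{- Let $(G,\mathscr L)$ be an affine plane of order $n\geq 3$ and let $D\subseteq G$ be a set of $k\leq n-2$ points. Let $\mathscr L_D=\{L\setminus D: L\in\mathscr L\}$, so that $(G\setminus D,\mathscr L_D)$ is the induced linear subspace on $G\setminus D$. Define a relation $\varpi$ on $\mathscr L_D$ by declaring $L\setminus D$ and $M\setminus D$ (for $L,M\in\mathscr L$) related iff either $|L\cap D|=|M\cap D|=1$ and $L\cap D=M\cap D$, or neither $L$ nor $M$ meets $D$ in exactly one point and $L,M$ are parallel in $(G,\mathscr L)$ (i.e. equal or disjoint). Then $\varpi$ is a parallelism of $(G\setminus D,\mathscr L_D)$ with exactly $n+k+1$ blocks.
   Context: An affine plane of order $n$ is a linear space on $n^2$ points in which every line has $n$ points and, for every line $L$ and point $p\notin L$, there is a unique line through $p$ disjoint from $L$; it has $n+1$ parallel classes, each consisting of $n$ pairwise disjoint lines, and each point lies on $n+1$ lines. A linear space is a pair $(G,\mathscr L)$ of a set of points and a family of subsets (lines) such that every two distinct points lie on a line, two distinct lines meet in at most one point, and every line has at least two points. A parallelism of a linear space is an equivalence relation on its lines such that distinct lines in the same block are disjoint. -}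

module Defs where

open import Data.Nat using (ℕ; _≤_)
open import Data.Fin using (Fin)
open import Data.Fin.Subset using (Subset; _∈_; _∉_; _∩_; _─_; ∣_∣)
open import Data.Product using (Σ; ∃; ∃-syntax; _×_)
open import Data.Sum using (_⊎_)
open import Data.Empty using (⊥)
open import Relation.Binary.PropositionalEquality using (_≡_; _≢_)

Disjoint : ∀ {N} → Subset N → Subset N → Set
Disjoint L M = ∀ x → x ∈ L → x ∈ M → ⊥

Parallel : ∀ {N} → Subset N → Subset N → Set
Parallel L M = L ≡ M ⊎ Disjoint L M

record IsLinearSpace {N : ℕ} (ℒ : Subset N → Set) : Set where
  field
    join : ∀ (p q : Fin N) → p ≢ q → ∃[ L ] (ℒ L × p ∈ L × q ∈ L)
    meet : ∀ (L M : Subset N) → ℒ L → ℒ M → L ≢ M →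
           ∀ (p q : Fin N) → p ∈ L → p ∈ M → q ∈ L → q ∈ M → p ≡ q
    twoPoints : ∀ (L : Subset N) → ℒ L → 2 ≤ ∣ L ∣

record IsAffinePlane (n : ℕ) (ℒ : Subset (n Data.Nat.* n) → Set) : Set where
  field
    linear : IsLinearSpace ℒ
    lineSize : ∀ L → ℒ L → ∣ L ∣ ≡ n
    parallelAxiom : ∀ L (p : Fin (n Data.Nat.* n)) → ℒ L → p ∉ L →
      Σ (Subset (n Data.Nat.* n)) λ M → (ℒ M × p ∈ M × Disjoint L M ×
        (∀ M' → ℒ M' → p ∈ M' → Disjoint L M' → M' ≡ M))

LinesD : ∀ {N} → (Subset N → Set) → Subset N → Subset N → Set
LinesD ℒ D X = ∃[ L ] (ℒ L × X ≡ L ─ D)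

Varpi : ∀ {N} → (Subset N → Set) → Subset N → Subset N → Subset N → Set
Varpi ℒ D X Y = ∃[ L ] ∃[ M ] (ℒ L × ℒ M × X ≡ L ─ D × Y ≡ M ─ D ×
  ((∣ L ∩ D ∣ ≡ 1 × ∣ M ∩ D ∣ ≡ 1 × L ∩ D ≡ M ∩ D)
   ⊎ (∣ L ∩ D ∣ ≢ 1 × ∣ M ∩ D ∣ ≢ 1 × Parallel L M)))

record IsParallelism {N : ℕ} (𝓛 : Subset N → Set)
                     (R : Subset N → Subset N → Set) : Set where
  field
    refl' : ∀ X → 𝓛 X → R X X
    sym' : ∀ X Y → 𝓛 X → 𝓛 Y → R X Y → R Y X
    trans' : ∀ X Y Z → 𝓛 X → 𝓛 Y → 𝓛 Z → R X Y → R Y Z → R X Z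
    disjoint : ∀ X Y → 𝓛 X → 𝓛 Y → R X Y → X ≢ Y → Disjoint X Y

HasExactlyBlocks : ∀ {N} → (Subset N → Set) → (Subset N → Subset N → Set) → ℕ → Set
HasExactlyBlocks {N} 𝓛 R m =
  Σ (Subset N → Fin m) λ f →
    (∀ X Y → 𝓛 X → 𝓛 Y → (R X Y → f X ≡ f Y) × (f X ≡ f Y → R X Y)) ×
    (∀ (i : Fin m) → ∃[ X ] (𝓛 X × f X ≡ i))

-- Fix a line L₀ and a point p₀ off it. Each parallel class contains exactly one line through p₀,
-- which either meets L₀ in one point or misses it, so the classes ("directions") are indexed by
-- 1 + ∣L₀∣ = n + 1 values. Since k ≤ n - 2, every L ─ D has two points, which recover L, so ϖ is
-- the kernel of the map sending L ─ D to the point of D if ∣L ∩ D∣ = 1 and to the direction of L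
-- otherwise; hence ϖ is an equivalence, and related distinct sets are disjoint because distinct
-- lines through a common point of D meet nowhere else. The map is onto Fin k ⊎ Fin (n + 1) by
-- two counting arguments: for p ∈ D, the lines from p to the other points of D use fewer than
-- n + 1 directions, and the line through p in an unused direction meets D only at p; in each
-- parallel class the k < n points of D lie on at most k of its n lines, so one line misses D.
module Submission where

open import Data.Bool.Properties as Bool using ()
open import Data.Fin as Fin using (Fin; zero; suc)
open import Data.Fin.Properties as Fin using ()
open import Data.Fin.Subset
  using (Subset; ⊤; inside; outside; _∈_; _∉_; _⊆_; _∩_; _─_; _-_; ⁅_⁆; ∣_∣; Nonempty)
open import Data.Fin.Subset.Properties
open import Data.Nat as ℕ using (ℕ; suc; _+_; _*_; _≤_; _<_; _≤?_; z≤n; s≤s)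
open import Data.Nat.Properties as ℕ using ()
open import Data.Product using (Σ; ∃; ∃₂; _×_; _,_; proj₁; proj₂)
open import Data.Sum using (_⊎_; inj₁; inj₂)
open import Data.Sum.Properties using (inj₁-injective; inj₂-injective)
open import Data.Vec using ([]; _∷_; here; there)
open import Data.Vec.Properties using (≡-dec)
open import Function using (_∘′_)
open import Function.Bundles using (_↔_; Inverse)
open import Relation.Binary.PropositionalEquality
open import Relation.Nullary using (Dec; yes; no; ¬_; ¬?; contradiction)

open import Defs

-- Finite subsets

x∈p─q⇒x∉q : ∀ {N} (p q : Subset N) {x} → x ∈ p ─ q → x ∉ q
x∈p─q⇒x∉q (_ ∷ p) (outside ∷ q) here        ()
x∈p─q⇒x∉q (_ ∷ p) (_       ∷ q) (there x∈) (there x∈q) = x∈p─q⇒x∉q p q x∈ x∈q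

∣p∣≤∣p─q∣+∣q∣ : ∀ {N} (p q : Subset N) → ∣ p ∣ ≤ ∣ p ─ q ∣ + ∣ q ∣
∣p∣≤∣p─q∣+∣q∣ []            []            = z≤n
∣p∣≤∣p─q∣+∣q∣ (inside  ∷ p) (inside  ∷ q) =
  subst (suc ∣ p ∣ ≤_) (sym (ℕ.+-suc _ _)) (s≤s (∣p∣≤∣p─q∣+∣q∣ p q))
∣p∣≤∣p─q∣+∣q∣ (inside  ∷ p) (outside ∷ q) = s≤s (∣p∣≤∣p─q∣+∣q∣ p q)
∣p∣≤∣p─q∣+∣q∣ (outside ∷ p) (inside  ∷ q) =
  subst (∣ p ∣ ≤_) (sym (ℕ.+-suc _ _)) (ℕ.m≤n⇒m≤1+n (∣p∣≤∣p─q∣+∣q∣ p q))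
∣p∣≤∣p─q∣+∣q∣ (outside ∷ p) (outside ∷ q) = ∣p∣≤∣p─q∣+∣q∣ p q

x∈p⇒1≤∣p∣ : ∀ {N} {p : Subset N} {x} → x ∈ p → 1 ≤ ∣ p ∣
x∈p⇒1≤∣p∣ {x = x} x∈p = subst (_≤ _) (∣⁅x⁆∣≡1 x)
  (p⊆q⇒∣p∣≤∣q∣ λ y∈⁅x⁆ → subst (_∈ _) (sym (x∈⁅y⁆⇒x≡y x y∈⁅x⁆)) x∈p)

1≤∣p∣⇒Nonempty : ∀ {N} (p : Subset N) → 1 ≤ ∣ p ∣ → Nonempty p
1≤∣p∣⇒Nonempty {N} p 1≤∣p∣ with nonempty? p
... | yes p≠∅ = p≠∅
... | no  p=∅ =
  contradiction (subst (λ q → 1 ≤ ∣ q ∣) (Empty-unique p=∅) 1≤∣p∣) (ℕ.<-irrefl (sym (∣⊥∣≡0 N)))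

2≤∣p∣⇒∃₂≢ : ∀ {N} (p : Subset N) → 2 ≤ ∣ p ∣ → ∃₂ λ x y → x ∈ p × y ∈ p × x ≢ y
2≤∣p∣⇒∃₂≢ p 2≤∣p∣ with 1≤∣p∣⇒Nonempty p (ℕ.≤-trans (ℕ.n≤1+n 1) 2≤∣p∣)
... | x , x∈p with 1≤∣p∣⇒Nonempty (p - x) 1≤∣p-x∣
  where
  1≤∣p-x∣ : 1 ≤ ∣ p - x ∣
  1≤∣p-x∣ = ℕ.+-cancelʳ-≤ 1 1 ∣ p - x ∣
    (subst (2 ≤_) (cong (∣ p - x ∣ +_) (∣⁅x⁆∣≡1 x)) (ℕ.≤-trans 2≤∣p∣ (∣p∣≤∣p─q∣+∣q∣ p ⁅ x ⁆)))
... | y , y∈p-x =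
  x , y , x∈p , p─q⊆p p ⁅ x ⁆ y∈p-x , λ { refl → x∈p─q⇒x∉q p ⁅ x ⁆ y∈p-x (x∈⁅x⁆ x) }

∣p∣≡1⇒p≡⁅x⁆ : ∀ {N} {p : Subset N} {x} → ∣ p ∣ ≡ 1 → x ∈ p → p ≡ ⁅ x ⁆
∣p∣≡1⇒p≡⁅x⁆ {p = p} {x} ∣p∣≡1 x∈p =
  ⊆-antisym only-x (λ y∈⁅x⁆ → subst (_∈ p) (sym (x∈⁅y⁆⇒x≡y x y∈⁅x⁆)) x∈p)
  where
  only-x : p ⊆ ⁅ x ⁆
  only-x {y} y∈p with y Fin.≟ x
  ... | yes refl = x∈⁅x⁆ x
  ... | no  y≢x  = contradiction (subst (∣ p - x ∣ <_) ∣p∣≡1 (x∈p⇒∣p-x∣<∣p∣ x∈p))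
                                (ℕ.≤⇒≯ (x∈p⇒1≤∣p∣ (x∈p∧x≢y⇒x∈p-y y∈p y≢x)))

∈-irrelevant : ∀ {N} {p : Subset N} {x} (a b : x ∈ p) → a ≡ b
∈-irrelevant here      here      = refl
∈-irrelevant (there a) (there b) = cong there (∈-irrelevant a b)

index : ∀ {N} (p : Subset N) {x} → x ∈ p → Fin ∣ p ∣
index (inside  ∷ p) here        = zero
index (inside  ∷ p) (there x∈p) = suc (index p x∈p)
index (outside ∷ p) (there x∈p) = index p x∈p

enum : ∀ {N} (p : Subset N) → Fin ∣ p ∣ → Fin N
enum (inside  ∷ p) zero    = zero
enum (inside  ∷ p) (suc i) = suc (enum p i)
enum (outside ∷ p) i       = suc (enum p i)

enum∈ : ∀ {N} (p : Subset N) (i : Fin ∣ p ∣) → enum p i ∈ p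
enum∈ (inside  ∷ p) zero    = here
enum∈ (inside  ∷ p) (suc i) = there (enum∈ p i)
enum∈ (outside ∷ p) i       = there (enum∈ p i)

index-enum∈ : ∀ {N} (p : Subset N) (i : Fin ∣ p ∣) → index p (enum∈ p i) ≡ i
index-enum∈ (inside  ∷ p) zero    = refl
index-enum∈ (inside  ∷ p) (suc i) = cong suc (index-enum∈ p i)
index-enum∈ (outside ∷ p) i       = index-enum∈ p i

enum-index : ∀ {N} (p : Subset N) {x} (x∈p : x ∈ p) → enum p (index p x∈p) ≡ x
enum-index (inside  ∷ p) here        = refl
enum-index (inside  ∷ p) (there x∈p) = cong suc (enum-index p x∈p)
enum-index (outside ∷ p) (there x∈p) = cong suc (enum-index p x∈p)

index-cong : ∀ {N} (p : Subset N) {x y} (x∈p : x ∈ p) (y∈p : y ∈ p) →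
             x ≡ y → index p x∈p ≡ index p y∈p
index-cong p x∈p y∈p refl = cong (index p) (∈-irrelevant x∈p y∈p)

index-injective : ∀ {N} (p : Subset N) {x y} (x∈p : x ∈ p) (y∈p : y ∈ p) →
                  index p x∈p ≡ index p y∈p → x ≡ y
index-injective p x∈p y∈p eq =
  trans (sym (enum-index p x∈p)) (trans (cong (enum p) eq) (enum-index p y∈p))

<⇒∃-unhit : ∀ {a b} → a < b → (φ : Fin a → Fin b) → ∃ λ j → ∀ i → φ i ≢ j
<⇒∃-unhit {a} {b} a<b φ with Fin.any? (λ j → Fin.all? λ i → ¬? (φ i Fin.≟ j))
... | yes unhit = unhit
... | no  ¬unhit = contradiction (Fin.injective⇒≤ section-injective) (ℕ.<⇒≱ a<b)
  where
  preimage : ∀ j → ∃ λ i → φ i ≡ j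
  preimage j with Fin.any? (λ i → φ i Fin.≟ j)
  ... | yes hit  = hit
  ... | no  ¬hit = contradiction (j , λ i φi≡j → ¬hit (i , φi≡j)) ¬unhit
  section-injective : ∀ {j j′} → proj₁ (preimage j) ≡ proj₁ (preimage j′) → j ≡ j′
  section-injective {j} {j′} eq =
    trans (sym (proj₂ (preimage j))) (trans (cong φ eq) (proj₂ (preimage j′)))

∣p∣<∣q∣⇒∃-unhit : ∀ {M N} {p : Subset M} {q : Subset N} (g : Fin M → Fin N) →
                  (∀ {x} → x ∈ p → g x ∈ q) → ∣ p ∣ < ∣ q ∣ →
                  ∃ λ y → y ∈ q × ∀ {x} → x ∈ p → g x ≢ y
∣p∣<∣q∣⇒∃-unhit {p = p} {q} g g∈q ∣p∣<∣q∣ = enum q j , enum∈ q j , unhit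
  where
  φ : Fin ∣ p ∣ → Fin ∣ q ∣
  φ i = index q (g∈q (enum∈ p i))
  j : Fin ∣ q ∣
  j = proj₁ (<⇒∃-unhit ∣p∣<∣q∣ φ)
  unhit : ∀ {x} → x ∈ p → g x ≢ enum q j
  unhit {x} x∈p gx≡y = proj₂ (<⇒∃-unhit ∣p∣<∣q∣ φ) (index p x∈p) (begin
    φ (index p x∈p)     ≡⟨ index-cong q _ (g∈q x∈p) (cong g (enum-index p x∈p)) ⟩
    index q (g∈q x∈p)   ≡⟨ index-cong q _ (enum∈ q j) gx≡y ⟩
    index q (enum∈ q j) ≡⟨ index-enum∈ q j ⟩
    j                   ∎)
    where open ≡-Reasoning

-- Parallelism and partitions

Parallel-sym : ∀ {N} {A B : Subset N} → Parallel A B → Parallel B A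
Parallel-sym (inj₁ A≡B)  = inj₁ (sym A≡B)
Parallel-sym (inj₂ A#B) = inj₂ λ x x∈B x∈A → A#B x x∈A x∈B

Parallel∧meet⇒≡ : ∀ {N} {A B : Subset N} {x} → Parallel A B → x ∈ A → x ∈ B → A ≡ B
Parallel∧meet⇒≡         (inj₁ A≡B)  _   _   = A≡B
Parallel∧meet⇒≡ {x = x} (inj₂ A#B) x∈A x∈B = contradiction x∈B (A#B x x∈A)

¬Parallel⇒meet : ∀ {N} {A B : Subset N} → ¬ Parallel A B → ∃ λ x → x ∈ A × x ∈ B
¬Parallel⇒meet {A = A} {B} A∦B with nonempty? (A ∩ B)
... | yes (x , x∈A∩B) = x , x∈p∩q⁻ A B x∈A∩B
... | no  A∩B=∅      = contradiction (inj₂ λ x x∈A x∈B → A∩B=∅ (x , x∈p∩q⁺ (x∈A , x∈B))) A∦B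

Parallel? : ∀ {N} (A B : Subset N) → Dec (Parallel A B)
Parallel? A B with ≡-dec Bool._≟_ A B | nonempty? (A ∩ B)
... | yes A≡B | _                = yes (inj₁ A≡B)
... | no  _   | no  A∩B=∅       = yes (inj₂ λ x x∈A x∈B → A∩B=∅ (x , x∈p∩q⁺ (x∈A , x∈B)))
... | no  A≢B | yes (x , x∈A∩B) =
  no λ A∥B → A≢B (Parallel∧meet⇒≡ A∥B (proj₁ (x∈p∩q⁻ A B x∈A∩B)) (proj₂ (x∈p∩q⁻ A B x∈A∩B)))

Kernel : ∀ {N} {A : Set} → (Subset N → Set) → (Subset N → Subset N → Set) → (Subset N → A) → Set
Kernel 𝓛 R f = ∀ X Y → 𝓛 X → 𝓛 Y → (R X Y → f X ≡ f Y) × (f X ≡ f Y → R X Y)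

kernel⇒IsParallelism : ∀ {N} {A : Set} {𝓛 : Subset N → Set} {R : Subset N → Subset N → Set}
                       (f : Subset N → A) → Kernel 𝓛 R f →
                       (∀ X Y → 𝓛 X → 𝓛 Y → R X Y → X ≢ Y → Disjoint X Y) → IsParallelism 𝓛 R
kernel⇒IsParallelism f ker disjoint = record
  { refl'    = λ X 𝓛X → proj₂ (ker X X 𝓛X 𝓛X) refl
  ; sym'     = λ X Y 𝓛X 𝓛Y R-XY → proj₂ (ker Y X 𝓛Y 𝓛X) (sym (proj₁ (ker X Y 𝓛X 𝓛Y) R-XY))
  ; trans'   = λ X Y Z 𝓛X 𝓛Y 𝓛Z R-XY R-YZ → proj₂ (ker X Z 𝓛X 𝓛Z)
                 (trans (proj₁ (ker X Y 𝓛X 𝓛Y) R-XY) (proj₁ (ker Y Z 𝓛Y 𝓛Z) R-YZ))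
  ; disjoint = disjoint
  }

kernel⇒HasExactlyBlocks : ∀ {N m} {A : Set} {𝓛 : Subset N → Set} {R : Subset N → Subset N → Set}
                          (f : Subset N → A) → Fin m ↔ A → Kernel 𝓛 R f →
                          (∀ a → ∃ λ X → 𝓛 X × f X ≡ a) → HasExactlyBlocks 𝓛 R m
kernel⇒HasExactlyBlocks {𝓛 = 𝓛} {R} f Fin↔A ker f-onto = from ∘′ f , from∘f-kernel , from∘f-onto
  where
  open Inverse Fin↔A using (to; from; strictlyInverseˡ; strictlyInverseʳ)
  from∘f-kernel : Kernel 𝓛 R (from ∘′ f)
  from∘f-kernel X Y 𝓛X 𝓛Y = cong from ∘′ proj₁ (ker X Y 𝓛X 𝓛Y) , λ eq → proj₂ (ker X Y 𝓛X 𝓛Y)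
    (trans (sym (strictlyInverseˡ (f X))) (trans (cong to eq) (strictlyInverseˡ (f Y))))
  from∘f-onto : ∀ i → ∃ λ X → 𝓛 X × from (f X) ≡ i
  from∘f-onto i =
    let (X , 𝓛X , fX≡to-i) = f-onto (to i)
    in X , 𝓛X , trans (cong from fX≡to-i) (strictlyInverseʳ i)

-- Linear spaces and affine planes

module LinearSpace {N} {ℒ : Subset N → Set} (LS : IsLinearSpace ℒ) where
  open IsLinearSpace LS

  line-unique : ∀ {A B x y} → ℒ A → ℒ B → x ≢ y → x ∈ A → y ∈ A → x ∈ B → y ∈ B → A ≡ B
  line-unique {A} {B} {x} {y} ℒA ℒB x≢y x∈A y∈A x∈B y∈B with ≡-dec Bool._≟_ A B
  ... | yes A≡B = A≡B
  ... | no  A≢B = contradiction (meet A B ℒA ℒB A≢B x y x∈A x∈B y∈A y∈B) x≢y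

n<n*n : ∀ {n} → 1 < n → n < n * n
n<n*n {n@(suc _)} 1<n = ℕ.m<m*n n n 1<n

module AffinePlane {n} {ℒ : Subset (n * n) → Set} (AP : IsAffinePlane n ℒ) where
  open IsAffinePlane AP
  open IsLinearSpace linear
  open LinearSpace linear public

  Point : Set
  Point = Fin (n * n)

  parallelThrough : ∀ x A → ℒ A → ∃ λ B → ℒ B × x ∈ B × Parallel A B
  parallelThrough x A ℒA with x ∈? A
  ... | yes x∈A = A , ℒA , x∈A , inj₁ refl
  ... | no  x∉A =
    let (B , ℒB , x∈B , A#B , _) = parallelAxiom A x ℒA x∉A in B , ℒB , x∈B , inj₂ A#B

  Parallel-trans : ∀ {A B C} → ℒ A → ℒ B → ℒ C → Parallel A B → Parallel B C → Parallel A C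
  Parallel-trans _ _ _ (inj₁ refl) B∥C         = B∥C
  Parallel-trans _ _ _ A∥B         (inj₁ refl) = A∥B
  Parallel-trans {A} {B} {C} ℒA ℒB ℒC (inj₂ A#B) (inj₂ B#C) with nonempty? (A ∩ C)
  ... | no  A∩C=∅      = inj₂ λ x x∈A x∈C → A∩C=∅ (x , x∈p∩q⁺ (x∈A , x∈C))
  ... | yes (x , x∈A∩C) =
    let (x∈A , x∈C) = x∈p∩q⁻ A C x∈A∩C
        (_ , _ , _ , _ , unique) = parallelAxiom B x ℒB (A#B x x∈A)
    in inj₁ (trans (unique A ℒA x∈A (λ y y∈B y∈A → A#B y y∈A y∈B)) (sym (unique C ℒC x∈C B#C)))

  parallelThrough-unique : ∀ {A B C x} → ℒ A → ℒ B → ℒ C → x ∈ B → x ∈ C →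
                           Parallel A B → Parallel A C → B ≡ C
  parallelThrough-unique ℒA ℒB ℒC x∈B x∈C A∥B A∥C =
    Parallel∧meet⇒≡ (Parallel-trans ℒB ℒA ℒC (Parallel-sym A∥B) A∥C) x∈B x∈C

  ∃-line-and-point-off : 1 < n → ∃₂ λ L p → ℒ L × p ∉ L
  ∃-line-and-point-off 1<n =
    let 2≤∣⊤∣ = subst (2 ≤_) (sym (∣⊤∣≡n (n * n))) (ℕ.≤-trans 1<n (ℕ.<⇒≤ (n<n*n 1<n)))
        (x , y , _ , _ , x≢y) = 2≤∣p∣⇒∃₂≢ ⊤ 2≤∣⊤∣
        (L , ℒL , _) = join x y x≢y
        (p , p∉L) = Fin.¬∀⟶∃¬ (n * n) (_∈ L) (_∈? L) λ all∈L → ℕ.<⇒≱ (n<n*n 1<n) (begin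
          n * n         ≡⟨ sym (∣⊤∣≡n (n * n)) ⟩
          ∣ ⊤ {n * n} ∣ ≤⟨ p⊆q⇒∣p∣≤∣q∣ {p = ⊤} {q = L} (λ {x} _ → all∈L x) ⟩
          ∣ L ∣         ≡⟨ lineSize L ℒL ⟩
          n             ∎)
    in L , p , ℒL , p∉L
    where open ℕ.≤-Reasoning

  module Transversal {A T} (ℒA : ℒ A) (ℒT : ℒ T) (A∦T : ¬ Parallel A T) where

    meets : ∀ {B} → ℒ B → Parallel A B → ∃ λ x → x ∈ B × x ∈ T
    meets ℒB A∥B = ¬Parallel⇒meet λ B∥T → A∦T (Parallel-trans ℒA ℒB ℒT A∥B B∥T)

    crossing : Point → Point
    crossing q = let (_ , ℒB , _ , A∥B) = parallelThrough q A ℒA in proj₁ (meets ℒB A∥B)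

    crossing∈T : ∀ q → crossing q ∈ T
    crossing∈T q = let (_ , ℒB , _ , A∥B) = parallelThrough q A ℒA in proj₂ (proj₂ (meets ℒB A∥B))

    crossing-unique : ∀ {B q x} → ℒ B → Parallel A B → q ∈ B → x ∈ B → x ∈ T → crossing q ≡ x
    crossing-unique {B} {q} {x} ℒB A∥B q∈B x∈B x∈T with crossing q Fin.≟ x
    ... | yes c≡x = c≡x
    ... | no  c≢x =
      contradiction (subst (Parallel A) (line-unique ℒB ℒT c≢x c∈B x∈B (crossing∈T q) x∈T) A∥B) A∦T
      where
      c∈B : crossing q ∈ B
      c∈B = let (P , ℒP , q∈P , A∥P) = parallelThrough q A ℒA
            in subst (crossing q ∈_) (parallelThrough-unique ℒA ℒP ℒB q∈P q∈B A∥P A∥B)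
                     (proj₁ (proj₂ (meets ℒP A∥P)))

  module Directions {L₀} (ℒL₀ : ℒ L₀) {p₀} (p₀∉L₀ : p₀ ∉ L₀) where

    Direction : Set
    Direction = Fin (suc ∣ L₀ ∣)

    ∣Direction∣≡1+n : ∣ ⊤ {suc ∣ L₀ ∣} ∣ ≡ suc n
    ∣Direction∣≡1+n = trans (∣⊤∣≡n _) (cong suc (lineSize L₀ ℒL₀))

    slope′ : (B : Subset (n * n)) → Dec (Nonempty (B ∩ L₀)) → Direction
    slope′ B (yes (x , x∈B∩L₀)) = suc (index L₀ (proj₂ (x∈p∩q⁻ B L₀ x∈B∩L₀)))
    slope′ B (no  _)            = zero

    slope : Subset (n * n) → Direction
    slope B = slope′ B (nonempty? (B ∩ L₀))

    slope′-injective : ∀ {B C} → ℒ B → ℒ C → p₀ ∈ B → p₀ ∈ C →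
                       ∀ d e → slope′ B d ≡ slope′ C e → B ≡ C
    slope′-injective {B} {C} ℒB ℒC p₀∈B p₀∈C (yes (x , x∈B∩L₀)) (yes (y , y∈C∩L₀)) eq =
      line-unique ℒB ℒC p₀≢x p₀∈B (proj₁ (x∈p∩q⁻ B L₀ x∈B∩L₀))
                  p₀∈C (subst (_∈ C) (sym x≡y) (proj₁ (x∈p∩q⁻ C L₀ y∈C∩L₀)))
      where
      x≡y = index-injective L₀ _ _ (Fin.suc-injective eq)
      p₀≢x : p₀ ≢ x
      p₀≢x refl = p₀∉L₀ (proj₂ (x∈p∩q⁻ B L₀ x∈B∩L₀))
    slope′-injective {B} {C} ℒB ℒC p₀∈B p₀∈C (no B∩L₀=∅) (no C∩L₀=∅) _ =
      parallelThrough-unique ℒL₀ ℒB ℒC p₀∈B p₀∈C (inj₂ (apart B∩L₀=∅)) (inj₂ (apart C∩L₀=∅))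
      where
      apart : ∀ {M} → ¬ Nonempty (M ∩ L₀) → Disjoint L₀ M
      apart M∩L₀=∅ x x∈L₀ x∈M = M∩L₀=∅ (x , x∈p∩q⁺ (x∈M , x∈L₀))
    slope′-injective _ _ _ _ (yes _) (no  _) ()
    slope′-injective _ _ _ _ (no  _) (yes _) ()

    slope′-meet : ∀ {B x} → ℒ B → p₀ ∈ B → x ∈ B → (x∈L₀ : x ∈ L₀) →
                  ∀ d → slope′ B d ≡ suc (index L₀ x∈L₀)
    slope′-meet {B} {x} ℒB p₀∈B x∈B x∈L₀ (yes (y , y∈B∩L₀)) with y Fin.≟ x
    ... | yes y≡x = cong suc (index-cong L₀ _ x∈L₀ y≡x)
    ... | no  y≢x =
      let (y∈B , y∈L₀) = x∈p∩q⁻ B L₀ y∈B∩L₀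
      in contradiction (subst (p₀ ∈_) (line-unique ℒB ℒL₀ y≢x y∈B x∈B y∈L₀ x∈L₀) p₀∈B) p₀∉L₀
    slope′-meet {B} {x} _ _ x∈B x∈L₀ (no B∩L₀=∅) = contradiction (x , x∈p∩q⁺ (x∈B , x∈L₀)) B∩L₀=∅

    slope′-disjoint : ∀ {B} → Disjoint L₀ B → ∀ d → slope′ B d ≡ zero
    slope′-disjoint {B} L₀#B (yes (x , x∈B∩L₀)) =
      contradiction (proj₁ (x∈p∩q⁻ B L₀ x∈B∩L₀)) (L₀#B x (proj₂ (x∈p∩q⁻ B L₀ x∈B∩L₀)))
    slope′-disjoint _ (no _) = refl

    slope-surjective : ∀ c → ∃ λ B → ℒ B × p₀ ∈ B × slope B ≡ c
    slope-surjective zero =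
      let (B , ℒB , p₀∈B , L₀#B , _) = parallelAxiom L₀ p₀ ℒL₀ p₀∉L₀
      in B , ℒB , p₀∈B , slope′-disjoint L₀#B _
    slope-surjective (suc i) =
      let x∈L₀ = enum∈ L₀ i
          (B , ℒB , p₀∈B , x∈B) =
            join p₀ (enum L₀ i) λ p₀≡x → p₀∉L₀ (subst (_∈ L₀) (sym p₀≡x) x∈L₀)
      in B , ℒB , p₀∈B , trans (slope′-meet ℒB p₀∈B x∈B x∈L₀ _) (cong suc (index-enum∈ L₀ i))

    direction : (A : Subset (n * n)) → ℒ A → Direction
    direction A ℒA = slope (proj₁ (parallelThrough p₀ A ℒA))

    direction-through : ∀ {B} (ℒB : ℒ B) → p₀ ∈ B → direction B ℒB ≡ slope B
    direction-through {B} ℒB p₀∈B =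
      let (P , _ , p₀∈P , B∥P) = parallelThrough p₀ B ℒB
      in cong slope (Parallel∧meet⇒≡ (Parallel-sym B∥P) p₀∈P p₀∈B)

    Parallel⇒direction≡ : ∀ {A B} (ℒA : ℒ A) (ℒB : ℒ B) →
                          Parallel A B → direction A ℒA ≡ direction B ℒB
    Parallel⇒direction≡ {A} {B} ℒA ℒB A∥B =
      let (P , ℒP , p₀∈P , A∥P) = parallelThrough p₀ A ℒA
          (Q , ℒQ , p₀∈Q , B∥Q) = parallelThrough p₀ B ℒB
      in cong slope (parallelThrough-unique ℒA ℒP ℒQ p₀∈P p₀∈Q A∥P (Parallel-trans ℒA ℒB ℒQ A∥B B∥Q))

    direction≡⇒Parallel : ∀ {A B} (ℒA : ℒ A) (ℒB : ℒ B) →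
                          direction A ℒA ≡ direction B ℒB → Parallel A B
    direction≡⇒Parallel {A} {B} ℒA ℒB eq =
      let (P , ℒP , p₀∈P , A∥P) = parallelThrough p₀ A ℒA
          (Q , ℒQ , p₀∈Q , B∥Q) = parallelThrough p₀ B ℒB
          P≡Q = slope′-injective ℒP ℒQ p₀∈P p₀∈Q _ _ eq
      in Parallel-trans ℒA ℒQ ℒB (subst (Parallel A) P≡Q A∥P) (Parallel-sym B∥Q)

    direction-surjective : ∀ c → ∃ λ A → Σ (ℒ A) λ ℒA → direction A ℒA ≡ c
    direction-surjective c =
      let (B , ℒB , p₀∈B , slope≡c) = slope-surjective c
      in B , ℒB , trans (direction-through ℒB p₀∈B) slope≡c

    ∃-nonParallel : ∀ A → ℒ A → ∃ λ T → ℒ T × ¬ Parallel A T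
    ∃-nonParallel A ℒA with Parallel? A L₀
    ... | no  A∦L₀ = L₀ , ℒL₀ , A∦L₀
    ... | yes A∥L₀ =
      let (x , x∈L₀) = 1≤∣p∣⇒Nonempty L₀ (ℕ.≤-trans (ℕ.n≤1+n 1) (twoPoints L₀ ℒL₀))
          (T , ℒT , p₀∈T , x∈T) = join p₀ x λ p₀≡x → p₀∉L₀ (subst (_∈ L₀) (sym p₀≡x) x∈L₀)
          L₀∦T : ¬ Parallel L₀ T
          L₀∦T L₀∥T = p₀∉L₀ (subst (p₀ ∈_) (sym (Parallel∧meet⇒≡ L₀∥T x∈L₀ x∈T)) p₀∈T)
      in T , ℒT , λ A∥T → L₀∦T (Parallel-trans ℒL₀ ℒA ℒT (Parallel-sym A∥L₀) A∥T)

    -- Lines parallel to A through the points of S cross a transversal in at most ∣ S ∣ < n points.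
    parallel-avoiding : ∀ {S} → ∣ S ∣ < n → ∀ A → ℒ A → ∃ λ B → ℒ B × Parallel A B × Disjoint B S
    parallel-avoiding {S} ∣S∣<n A ℒA =
      let (T , ℒT , A∦T) = ∃-nonParallel A ℒA
          open Transversal ℒA ℒT A∦T
          (t , t∈T , unhit) = ∣p∣<∣q∣⇒∃-unhit {p = S} crossing (λ {q} _ → crossing∈T q)
                                (subst (∣ S ∣ <_) (sym (lineSize T ℒT)) ∣S∣<n)
          (B , ℒB , t∈B , A∥B) = parallelThrough t A ℒA
      in B , ℒB , A∥B , λ q q∈B q∈S → unhit q∈S (crossing-unique ℒB A∥B q∈B t∈B t∈T)

    -- The value at q = p is junk; it only removes one more direction in line-meeting-only-at.
    joinDirection : Point → Point → Direction
    joinDirection p q with p Fin.≟ q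
    ... | yes _   = zero
    ... | no  p≢q = let (L , ℒL , _) = join p q p≢q in direction L ℒL

    joinDirection-on : ∀ {B p q} (ℒB : ℒ B) → p ∈ B → q ∈ B → p ≢ q →
                       joinDirection p q ≡ direction B ℒB
    joinDirection-on {p = p} {q} ℒB p∈B q∈B p≢q with p Fin.≟ q
    ... | yes p≡q = contradiction p≡q p≢q
    ... | no  p≢q = let (L , ℒL , p∈L , q∈L) = join p q p≢q
                    in Parallel⇒direction≡ ℒL ℒB (inj₁ (line-unique ℒL ℒB p≢q p∈L q∈L p∈B q∈B))

    line-meeting-only-at : ∀ {S p} → ∣ S ∣ ≤ n → p ∈ S → ∃ λ B → ℒ B × B ∩ S ≡ ⁅ p ⁆
    line-meeting-only-at {S} {p} ∣S∣≤n p∈S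
      with c , _ , unhit ← ∣p∣<∣q∣⇒∃-unhit {p = S} {q = ⊤} (joinDirection p) (λ _ → ∈⊤)
                             (subst (∣ S ∣ <_) (sym ∣Direction∣≡1+n) (s≤s ∣S∣≤n))
      with A , ℒA , direction≡c ← direction-surjective c
      with B , ℒB , p∈B , A∥B ← parallelThrough p A ℒA
      = B , ℒB , ⊆-antisym only-p
                   (λ q∈⁅p⁆ → subst (_∈ B ∩ S) (sym (x∈⁅y⁆⇒x≡y p q∈⁅p⁆)) (x∈p∩q⁺ (p∈B , p∈S)))
      where
      only-p : B ∩ S ⊆ ⁅ p ⁆
      only-p {q} q∈B∩S with p Fin.≟ q
      ... | yes refl = x∈⁅x⁆ p
      ... | no  p≢q  =
        let (q∈B , q∈S) = x∈p∩q⁻ B S q∈B∩S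
        in contradiction (begin
          joinDirection p q ≡⟨ joinDirection-on ℒB p∈B q∈B p≢q ⟩
          direction B ℒB    ≡⟨ Parallel⇒direction≡ ℒB ℒA (Parallel-sym A∥B) ⟩
          direction A ℒA    ≡⟨ direction≡c ⟩
          c                 ∎) (unhit q∈S)
        where open ≡-Reasoning

-- The punctured plane

module Punctured {n} {ℒ : Subset (n * n) → Set} (AP : IsAffinePlane n ℒ)
                 {L₀ p₀} (ℒL₀ : ℒ L₀) (p₀∉L₀ : p₀ ∉ L₀)
                 (D : Subset (n * n)) (∣D∣+2≤n : ∣ D ∣ + 2 ≤ n) where
  open IsAffinePlane AP
  open IsLinearSpace linear
  open AffinePlane AP
  open Directions ℒL₀ p₀∉L₀

  ∣D∣<n : ∣ D ∣ < n
  ∣D∣<n = ℕ.<-≤-trans (ℕ.m<m+n ∣ D ∣ (s≤s z≤n)) ∣D∣+2≤n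

  2≤∣L─D∣ : ∀ {L} → ℒ L → 2 ≤ ∣ L ─ D ∣
  2≤∣L─D∣ {L} ℒL = ℕ.+-cancelʳ-≤ (∣ D ∣) 2 (∣ L ─ D ∣) (begin
    2 + ∣ D ∣         ≡⟨ ℕ.+-comm 2 ∣ D ∣ ⟩
    ∣ D ∣ + 2         ≤⟨ ∣D∣+2≤n ⟩
    n                 ≡⟨ sym (lineSize L ℒL) ⟩
    ∣ L ∣             ≤⟨ ∣p∣≤∣p─q∣+∣q∣ L D ⟩
    ∣ L ─ D ∣ + ∣ D ∣ ∎)
    where open ℕ.≤-Reasoning

  VarpiLines : Subset (n * n) → Subset (n * n) → Set
  VarpiLines L M = (∣ L ∩ D ∣ ≡ 1 × ∣ M ∩ D ∣ ≡ 1 × L ∩ D ≡ M ∩ D)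
                 ⊎ (∣ L ∩ D ∣ ≢ 1 × ∣ M ∩ D ∣ ≢ 1 × Parallel L M)

  VarpiLines-refl : ∀ L → VarpiLines L L
  VarpiLines-refl L with ∣ L ∩ D ∣ ℕ.≟ 1
  ... | yes once  = inj₁ (once , once , refl)
  ... | no  ¬once = inj₂ (¬once , ¬once , inj₁ refl)

  meetingPoint : ∀ L → ∣ L ∩ D ∣ ≡ 1 → Nonempty (L ∩ D)
  meetingPoint L once = 1≤∣p∣⇒Nonempty (L ∩ D) (ℕ.≤-reflexive (sym once))

  VarpiLines-disjoint : ∀ {L M} → ℒ L → ℒ M → VarpiLines L M → L ≢ M → Disjoint (L ─ D) (M ─ D)
  VarpiLines-disjoint _ _ (inj₂ (_ , _ , inj₁ L≡M)) L≢M = contradiction L≡M L≢M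
  VarpiLines-disjoint {L} {M} _ _ (inj₂ (_ , _ , inj₂ L#M)) _ x x∈L─D x∈M─D =
    L#M x (p─q⊆p L D x∈L─D) (p─q⊆p M D x∈M─D)
  VarpiLines-disjoint {L} {M} ℒL ℒM (inj₁ (L-once , _ , L∩D≡M∩D)) L≢M x x∈L─D x∈M─D =
    let (p , p∈L∩D) = meetingPoint L L-once
        (p∈L , p∈D) = x∈p∩q⁻ L D p∈L∩D
        p∈M = proj₁ (x∈p∩q⁻ M D (subst (p ∈_) L∩D≡M∩D p∈L∩D))
        p≡x = meet L M ℒL ℒM L≢M p x p∈L p∈M (p─q⊆p L D x∈L─D) (p─q⊆p M D x∈M─D)
    in x∈p─q⇒x∉q L D x∈L─D (subst (_∈ D) p≡x p∈D)

  Block : Set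
  Block = Fin ∣ D ∣ ⊎ Direction

  block′ : (L : Subset (n * n)) → ℒ L → Dec (∣ L ∩ D ∣ ≡ 1) → Block
  block′ L ℒL (yes once) = inj₁ (index D (proj₂ (x∈p∩q⁻ L D (proj₂ (meetingPoint L once)))))
  block′ L ℒL (no  _)    = inj₂ (direction L ℒL)

  block : (L : Subset (n * n)) → ℒ L → Block
  block L ℒL = block′ L ℒL (∣ L ∩ D ∣ ℕ.≟ 1)

  block′≡⇒VarpiLines : ∀ {L M} (ℒL : ℒ L) (ℒM : ℒ M) d e →
                       block′ L ℒL d ≡ block′ M ℒM e → VarpiLines L M
  block′≡⇒VarpiLines {L} {M} _ _ (yes L-once) (yes M-once) eq = inj₁ (L-once , M-once , (begin
    L ∩ D ≡⟨ ∣p∣≡1⇒p≡⁅x⁆ L-once x∈L∩D ⟩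
    ⁅ x ⁆ ≡⟨ cong ⁅_⁆ (index-injective D _ _ (inj₁-injective eq)) ⟩
    ⁅ y ⁆ ≡⟨ ∣p∣≡1⇒p≡⁅x⁆ M-once y∈M∩D ⟨
    M ∩ D ∎))
    where
    open ≡-Reasoning
    x = proj₁ (meetingPoint L L-once)
    x∈L∩D = proj₂ (meetingPoint L L-once)
    y = proj₁ (meetingPoint M M-once)
    y∈M∩D = proj₂ (meetingPoint M M-once)
  block′≡⇒VarpiLines ℒL ℒM (no ¬L-once) (no ¬M-once) eq =
    inj₂ (¬L-once , ¬M-once , direction≡⇒Parallel ℒL ℒM (inj₂-injective eq))
  block′≡⇒VarpiLines _ _ (yes _) (no  _) ()
  block′≡⇒VarpiLines _ _ (no  _) (yes _) ()

  VarpiLines⇒block′≡ : ∀ {L M} (ℒL : ℒ L) (ℒM : ℒ M) d e →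
                       VarpiLines L M → block′ L ℒL d ≡ block′ M ℒM e
  VarpiLines⇒block′≡ {L} {M} _ _ (yes L-once) (yes M-once) (inj₁ (_ , _ , L∩D≡M∩D)) =
    cong inj₁ (index-cong D _ _ (sym (x∈⁅y⁆⇒x≡y x y∈⁅x⁆)))
    where
    x = proj₁ (meetingPoint L L-once)
    y∈⁅x⁆ : proj₁ (meetingPoint M M-once) ∈ ⁅ x ⁆
    y∈⁅x⁆ = subst (_ ∈_) (trans (sym L∩D≡M∩D) (∣p∣≡1⇒p≡⁅x⁆ L-once (proj₂ (meetingPoint L L-once))))
                  (proj₂ (meetingPoint M M-once))
  VarpiLines⇒block′≡ ℒL ℒM (no _) (no _) (inj₂ (_ , _ , L∥M)) =
    cong inj₂ (Parallel⇒direction≡ ℒL ℒM L∥M)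
  VarpiLines⇒block′≡ _ _ (yes L-once) _ (inj₂ (¬L-once , _))     = contradiction L-once ¬L-once
  VarpiLines⇒block′≡ _ _ _ (yes M-once) (inj₂ (_ , ¬M-once , _)) = contradiction M-once ¬M-once
  VarpiLines⇒block′≡ _ _ (no ¬L-once) _ (inj₁ (L-once , _))     = contradiction L-once ¬L-once
  VarpiLines⇒block′≡ _ _ _ (no ¬M-once) (inj₁ (_ , M-once , _)) = contradiction M-once ¬M-once

  block-cong : ∀ {L M} (ℒL : ℒ L) (ℒM : ℒ M) → L ≡ M → block L ℒL ≡ block M ℒM
  block-cong {L} ℒL ℒM refl = VarpiLines⇒block′≡ ℒL ℒM _ _ (VarpiLines-refl L)

  block′-once : ∀ {L p} (ℒL : ℒ L) → L ∩ D ≡ ⁅ p ⁆ → (p∈D : p ∈ D) →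
                ∀ d → block′ L ℒL d ≡ inj₁ (index D p∈D)
  block′-once {L} {p} ℒL L∩D≡⁅p⁆ p∈D (yes once) =
    cong inj₁ (index-cong D _ p∈D (x∈⁅y⁆⇒x≡y p (subst (_ ∈_) L∩D≡⁅p⁆ (proj₂ (meetingPoint L once)))))
  block′-once {p = p} ℒL L∩D≡⁅p⁆ p∈D (no ¬once) =
    contradiction (trans (cong ∣_∣ L∩D≡⁅p⁆) (∣⁅x⁆∣≡1 p)) ¬once

  block′-missing : ∀ {L} (ℒL : ℒ L) → Disjoint L D → ∀ d → block′ L ℒL d ≡ inj₂ (direction L ℒL)
  block′-missing {L} ℒL L#D (yes once) =
    let (x , x∈L∩D) = meetingPoint L once
        (x∈L , x∈D) = x∈p∩q⁻ L D x∈L∩D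
    in contradiction x∈D (L#D x x∈L)
  block′-missing ℒL L#D (no _) = refl

  block-surjective : ∀ b → ∃ λ L → Σ (ℒ L) λ ℒL → block L ℒL ≡ b
  block-surjective (inj₁ i) =
    let (L , ℒL , L∩D≡⁅p⁆) = line-meeting-only-at (ℕ.<⇒≤ ∣D∣<n) (enum∈ D i)
    in L , ℒL , trans (block′-once ℒL L∩D≡⁅p⁆ (enum∈ D i) _) (cong inj₁ (index-enum∈ D i))
  block-surjective (inj₂ c) =
    let (A , ℒA , direction≡c) = direction-surjective c
        (L , ℒL , A∥L , L#D) = parallel-avoiding ∣D∣<n A ℒA
    in L , ℒL , trans (block′-missing ℒL L#D _)
                      (cong inj₂ (trans (Parallel⇒direction≡ ℒL ℒA (Parallel-sym A∥L)) direction≡c))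

  -- The value on sets with fewer than two points is junk: no L ─ D is such a set.
  blockOf′ : (X : Subset (n * n)) → Dec (2 ≤ ∣ X ∣) → Block
  blockOf′ X (yes 2≤∣X∣) =
    let (x , y , _ , _ , x≢y) = 2≤∣p∣⇒∃₂≢ X 2≤∣X∣
        (L , ℒL , _) = join x y x≢y
    in block L ℒL
  blockOf′ X (no _) = inj₂ zero

  blockOf : Subset (n * n) → Block
  blockOf X = blockOf′ X (2 ≤? ∣ X ∣)

  blockOf′-─ : ∀ {L X} (ℒL : ℒ L) → X ≡ L ─ D → ∀ d → blockOf′ X d ≡ block L ℒL
  blockOf′-─ {L} {X} ℒL X≡L─D (yes 2≤∣X∣) =
    let (x , y , x∈X , y∈X , x≢y) = 2≤∣p∣⇒∃₂≢ X 2≤∣X∣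
        (M , ℒM , x∈M , y∈M) = join x y x≢y
        X⊆L = λ {z} (z∈X : z ∈ X) → p─q⊆p L D (subst (z ∈_) X≡L─D z∈X)
    in block-cong ℒM ℒL (line-unique ℒM ℒL x≢y x∈M y∈M (X⊆L x∈X) (X⊆L y∈X))
  blockOf′-─ ℒL refl (no 2≰∣X∣) = contradiction (2≤∣L─D∣ ℒL) 2≰∣X∣

  blockOf-─ : ∀ {L X} (ℒL : ℒ L) → X ≡ L ─ D → blockOf X ≡ block L ℒL
  blockOf-─ {X = X} ℒL X≡L─D = blockOf′-─ ℒL X≡L─D (2 ≤? ∣ X ∣)

  blockOf-kernel : Kernel (LinesD ℒ D) (Varpi ℒ D) blockOf
  blockOf-kernel X Y (L , ℒL , X≡L─D) (M , ℒM , Y≡M─D) = to , from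
    where
    to : Varpi ℒ D X Y → blockOf X ≡ blockOf Y
    to (L′ , M′ , ℒL′ , ℒM′ , X≡L′─D , Y≡M′─D , rel) = begin
      blockOf X    ≡⟨ blockOf-─ ℒL′ X≡L′─D ⟩
      block L′ ℒL′ ≡⟨ VarpiLines⇒block′≡ ℒL′ ℒM′ _ _ rel ⟩
      block M′ ℒM′ ≡⟨ blockOf-─ ℒM′ Y≡M′─D ⟨
      blockOf Y    ∎
      where open ≡-Reasoning
    from : blockOf X ≡ blockOf Y → Varpi ℒ D X Y
    from eq = L , M , ℒL , ℒM , X≡L─D , Y≡M─D , block′≡⇒VarpiLines ℒL ℒM _ _
      (trans (sym (blockOf-─ ℒL X≡L─D)) (trans eq (blockOf-─ ℒM Y≡M─D)))

  blockOf-surjective : ∀ b → ∃ λ X → LinesD ℒ D X × blockOf X ≡ b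
  blockOf-surjective b =
    let (L , ℒL , block≡b) = block-surjective b
    in L ─ D , (L , ℒL , refl) , trans (blockOf-─ ℒL refl) block≡b

  Varpi-disjoint : ∀ X Y → LinesD ℒ D X → LinesD ℒ D Y → Varpi ℒ D X Y → X ≢ Y → Disjoint X Y
  Varpi-disjoint _ _ _ _ (L , M , ℒL , ℒM , refl , refl , rel) X≢Y =
    VarpiLines-disjoint ℒL ℒM rel λ L≡M → X≢Y (cong (_─ D) L≡M)

  ∣Block∣≡n+∣D∣+1 : ∣ D ∣ + suc ∣ L₀ ∣ ≡ n + ∣ D ∣ + 1
  ∣Block∣≡n+∣D∣+1 = begin
    ∣ D ∣ + suc ∣ L₀ ∣ ≡⟨ cong (λ m → ∣ D ∣ + suc m) (lineSize L₀ ℒL₀) ⟩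
    ∣ D ∣ + suc n      ≡⟨ ℕ.+-suc ∣ D ∣ n ⟩
    suc (∣ D ∣ + n)    ≡⟨ cong suc (ℕ.+-comm ∣ D ∣ n) ⟩
    suc (n + ∣ D ∣)    ≡⟨ ℕ.+-comm 1 (n + ∣ D ∣) ⟩
    n + ∣ D ∣ + 1      ∎
    where open ≡-Reasoning

theorem31 : (n : ℕ) → 3 ≤ n → (ℒ : Subset (n * n) → Set) → IsAffinePlane n ℒ →
    (D : Subset (n * n)) → (k : ℕ) → ∣ D ∣ ≡ k → k + 2 ≤ n →
    IsParallelism (LinesD ℒ D) (Varpi ℒ D) ×
    HasExactlyBlocks (LinesD ℒ D) (Varpi ℒ D) (n + k + 1)
theorem31 n _ ℒ AP D _ refl ∣D∣+2≤n =
  let 1<n = ℕ.≤-trans (ℕ.m≤n+m 2 ∣ D ∣) ∣D∣+2≤n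
      (L₀ , p₀ , ℒL₀ , p₀∉L₀) = AffinePlane.∃-line-and-point-off AP 1<n
      open Punctured AP ℒL₀ p₀∉L₀ D ∣D∣+2≤n
  in kernel⇒IsParallelism blockOf blockOf-kernel Varpi-disjoint ,
     subst (HasExactlyBlocks (LinesD ℒ D) (Varpi ℒ D)) ∣Block∣≡n+∣D∣+1
           (kernel⇒HasExactlyBlocks blockOf Fin.+↔⊎ blockOf-kernel blockOf-surjective)
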